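{- If $B$ is a vertex (semiblock) of a round graph $\mathcal{H}$, then the semiblocks of $\mathcal{H}\setminus\{B\}$ that are not universal in $\mathcal{H}\setminus\{B\}$ and are not adjacent to $B$ lie in at most two co-components of $\mathcal{H}\setminus\{B\}$.
   Context: An ordered semiblock family is a sequence $B_1,\dots,B_k$ of pairwise disjoint nonempty sets; indices modulo $k$, $[B_i,B_j]$ denotes $B_i,B_{i+1},\dots,B_j$. A round representation is $\Phi=(\mathcal{B},F_r)$ with $F_r:\mathcal{B}\to\mathcal{B}$ and $F_r(B_i)\in[B_i,F_r(B_{i+1})]$ for all $i$; $B\to W$ means $W\in[B,F_r(B)]$, $W\ne B$; representations are normal (never both $B\to W$ and $W\to B$). A round graph is a graph of the form $\mathcal{G}(\Phi)$: vertex set $\mathcal{B}$, $B,W$ adjacent iff $B\to W$ or $W\to B$. A vertex is universal if adjacent to all other vertices. A co-component of a graph is the subgraph induced by a component of its complement. -}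

module Defs where

open import Data.Nat as ℕ using (ℕ; zero; suc; _≤_; _<_; s≤s)
open import Data.Nat.Properties using (_<?_; _≤?_)
open import Data.Fin using (Fin; toℕ; fromℕ<)
open import Data.Product using (_×_)
open import Data.Sum using (_⊎_)
open import Relation.Nullary using (¬_; yes; no)
open import Relation.Binary.PropositionalEquality using (_≡_; _≢_)
open import Relation.Binary.Construct.Closure.ReflexiveTransitive using (Star)

-- An ordered semiblock family B_1,…,B_k is represented by its index set Fin k
-- (the i-th semiblock is the vertex i); the graph G(Φ) only depends on indices.

next : ∀ {k} → Fin k → Fin k
next {suc n} i with toℕ i <? n
... | yes p = fromℕ< (s≤s p)
... | no _  = Fin.zero

-- w ∈ [i, j] : the cyclic interval i, i+1, …, j (indices mod k); [i,i] = {i}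
InInterval : ∀ {k} → Fin k → Fin k → Fin k → Set
InInterval i j w with toℕ i ≤? toℕ j
... | yes _ = (toℕ i ≤ toℕ w) × (toℕ w ≤ toℕ j)
... | no _  = (toℕ i ≤ toℕ w) ⊎ (toℕ w ≤ toℕ j)

record RoundRep (k : ℕ) : Set where
  field
    Fr : Fin k → Fin k
    round : ∀ i → InInterval i (Fr (next i)) (Fr i)

  _⇒_ : Fin k → Fin k → Set
  b ⇒ w = InInterval b (Fr b) w × w ≢ b

  field
    normal : ∀ b w → b ⇒ w → ¬ (w ⇒ b)

  Adj : Fin k → Fin k → Set
  Adj b w = (b ⇒ w) ⊎ (w ⇒ b)

open RoundRep public

module _ {k : ℕ} (Φ : RoundRep k) (B : Fin k) where

  UniversalMinus : Fin k → Set
  UniversalMinus w = ∀ x → x ≢ B → x ≢ w → Adj Φ w x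

  CoEdge : Fin k → Fin k → Set
  CoEdge x y = x ≢ B × y ≢ B × x ≢ y × ¬ Adj Φ x y

  SameCoComp : Fin k → Fin k → Set
  SameCoComp = Star CoEdge

  Candidate : Fin k → Set
  Candidate w = w ≢ B × ¬ UniversalMinus w × ¬ Adj Φ B w

-- Number the semiblocks cyclically starting from B, so that B gets position 0. A candidate W
-- is not adjacent to B, so its arc [W, F_r(W)] does not wrap around past B, and W lies beyond
-- F_r(B). Among three candidates a < b < c, either a and b are non-adjacent, or a → b. In the
-- latter case take a non-neighbour x of b (b is not universal). If x lies before b, it is not
-- adjacent to c, since an arc from x covering c would cover b. If x lies after b, it is not
-- adjacent to a: an arc from a covering x would, because F_r is monotone along the arc of a,
-- put x into the arc of b; and an arc from x covering a would wrap around past B, which forces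
-- F_r(x) ≤ F_r(B), too small to reach a candidate. Either way the middle candidate b shares a
-- co-component with a or with c.
module Submission where

open import Data.Empty using (⊥-elim)
open import Data.Fin using (Fin; toℕ) renaming (_≟_ to _≟ᶠ_)
open import Data.Fin.Properties using (toℕ<n; toℕ-injective; toℕ-fromℕ<; ¬∀⟶∃¬)
open import Data.Nat using (ℕ; zero; suc; _+_; _∸_; _≤_; _<_; z≤n; s≤s; z<s; _<?_; _≤?_)
open import Data.Nat.Properties
  using ( ≤-refl; ≤-trans; ≤-antisym; ≤-pred; ≤-reflexive; ≤-total; <-trans; <-≤-trans; ≤-<-trans
        ; <⇒≤; <⇒≢; >⇒≢; <⇒≱; ≰⇒>; ≮⇒≥; ≤∧≢⇒<; m<n⇒m<1+n; m<m+n; <-cmp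
        ; m≤n⇒m<n∨m≡n; +-identityʳ; +-suc; m+[n∸m]≡n )
open import Data.Product using (_×_; _,_; proj₁; proj₂; ∃)
open import Data.Sum using (_⊎_; inj₁; inj₂; [_,_]; swap)
open import Function using (_∘_; id)
open import Relation.Binary.Construct.Closure.ReflexiveTransitive using (ε; _◅_; reverse)
open import Relation.Binary.Definitions using (tri<; tri≈; tri>)
open import Relation.Binary.PropositionalEquality
  using (_≡_; _≢_; refl; sym; trans; cong; subst; subst₂; module ≡-Reasoning)
open import Relation.Nullary using (¬_; Dec; yes; no; contradiction)
open import Relation.Nullary.Decidable using (_×-dec_; _⊎-dec_; ¬?)

open import Defs

-- Arc x y z : the point z lies on the arc of the cyclic order running from x to y.
data Arc (x y z : ℕ) : Set where
  linear     : x ≤ z → z ≤ y → Arc x y z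
  wrap-above : y < x → x ≤ z → Arc x y z
  wrap-below : y < x → z ≤ y → Arc x y z

arc-end : ∀ x y → Arc x y y
arc-end x y with x ≤? y
... | yes x≤y = linear x≤y ≤-refl
... | no x≰y  = wrap-below (≰⇒> x≰y) ≤-refl

arc-linear : ∀ {x y z} → Arc x y z → x ≤ y → x ≤ z × z ≤ y
arc-linear (linear x≤z z≤y)   _   = x≤z , z≤y
arc-linear (wrap-above y<x _) x≤y = contradiction x≤y (<⇒≱ y<x)
arc-linear (wrap-below y<x _) x≤y = contradiction x≤y (<⇒≱ y<x)

arc-below-start : ∀ {x y z} → Arc x y z → z < x → y < x × z ≤ y
arc-below-start (linear x≤z _)       z<x = contradiction x≤z (<⇒≱ z<x)
arc-below-start (wrap-above _ x≤z)   z<x = contradiction x≤z (<⇒≱ z<x)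
arc-below-start (wrap-below y<x z≤y) _   = y<x , z≤y

arc-prefix : ∀ {x y z w} → Arc x y z → x ≤ w → w ≤ z → Arc x y w
arc-prefix (linear _ z≤y)       x≤w w≤z = linear x≤w (≤-trans w≤z z≤y)
arc-prefix (wrap-above y<x _)   x≤w _   = wrap-above y<x x≤w
arc-prefix (wrap-below y<x z≤y) _   w≤z = wrap-below y<x (≤-trans w≤z z≤y)

arc-trans : ∀ {r x y z} → Arc r y x → Arc r z y → Arc r z x
arc-trans (linear r≤x x≤y)    (linear _ y≤z)       = linear r≤x (≤-trans x≤y y≤z)
arc-trans (wrap-above y<r _)  (linear r≤y _)       = contradiction r≤y (<⇒≱ y<r)
arc-trans (wrap-below y<r _)  (linear r≤y _)       = contradiction r≤y (<⇒≱ y<r)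
arc-trans (linear r≤x _)      (wrap-above z<r _)   = wrap-above z<r r≤x
arc-trans (wrap-above y<r _)  (wrap-above _ r≤y)   = contradiction r≤y (<⇒≱ y<r)
arc-trans (wrap-below y<r _)  (wrap-above _ r≤y)   = contradiction r≤y (<⇒≱ y<r)
arc-trans (linear r≤x x≤y)    (wrap-below z<r y≤z) = contradiction (≤-trans r≤x x≤y) (<⇒≱ (≤-<-trans y≤z z<r))
arc-trans (wrap-above _ r≤x)  (wrap-below z<r _)   = wrap-above z<r r≤x
arc-trans (wrap-below _ x≤y)  (wrap-below z<r y≤z) = wrap-below z<r (≤-trans x≤y y≤z)

arc-drop-start : ∀ {r z x} → Arc r z x → x ≢ r → Arc (suc r) z x
arc-drop-start (linear r≤x x≤z)     x≢r = linear (≤∧≢⇒< r≤x (x≢r ∘ sym)) x≤z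
arc-drop-start (wrap-above z<r r≤x) x≢r = wrap-above (m<n⇒m<1+n z<r) (≤∧≢⇒< r≤x (x≢r ∘ sym))
arc-drop-start (wrap-below z<r x≤z) _   = wrap-below (m<n⇒m<1+n z<r) x≤z

inInterval⇒arc : ∀ {k} (i j w : Fin k) → InInterval i j w → Arc (toℕ i) (toℕ j) (toℕ w)
inInterval⇒arc i j w h with toℕ i ≤? toℕ j
... | yes _   = linear (proj₁ h) (proj₂ h)
... | no i≰j  = [ wrap-above (≰⇒> i≰j) , wrap-below (≰⇒> i≰j) ] h

arc⇒inInterval : ∀ {k} (i j w : Fin k) → Arc (toℕ i) (toℕ j) (toℕ w) → InInterval i j w
arc⇒inInterval i j w a with toℕ i ≤? toℕ j
... | yes i≤j = arc-linear a i≤j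
arc⇒inInterval i j w (linear i≤w _)     | no _ = inj₁ i≤w
arc⇒inInterval i j w (wrap-above _ i≤w) | no _ = inj₁ i≤w
arc⇒inInterval i j w (wrap-below _ w≤j) | no _ = inj₂ w≤j

inInterval? : ∀ {k} (i j w : Fin k) → Dec (InInterval i j w)
inInterval? i j w with toℕ i ≤? toℕ j
... | yes _ = (toℕ i ≤? toℕ w) ×-dec (toℕ w ≤? toℕ j)
... | no _  = (toℕ i ≤? toℕ w) ⊎-dec (toℕ w ≤? toℕ j)

module _ {k : ℕ} (Φ : RoundRep k) where

  adj? : ∀ u v → Dec (Adj Φ u v)
  adj? u v = (inInterval? u (Fr Φ u) v ×-dec ¬? (v ≟ᶠ u))
         ⊎-dec (inInterval? v (Fr Φ v) u ×-dec ¬? (u ≟ᶠ v))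

  adj-sym : ∀ {u v} → Adj Φ u v → Adj Φ v u
  adj-sym = swap

  module _ (B : Fin k) where

    ¬universal⇒non-neighbour : ∀ w → ¬ UniversalMinus Φ B w → ∃ λ x → x ≢ B × x ≢ w × ¬ Adj Φ w x
    ¬universal⇒non-neighbour w ¬univ
      with ¬∀⟶∃¬ k Excused (λ x → (x ≟ᶠ B) ⊎-dec ((x ≟ᶠ w) ⊎-dec adj? w x)) ¬allExcused
      where
      Excused : Fin k → Set
      Excused x = x ≡ B ⊎ x ≡ w ⊎ Adj Φ w x
      ¬allExcused : ¬ (∀ x → Excused x)
      ¬allExcused all = ¬univ λ x x≢B x≢w →
        [ ⊥-elim ∘ x≢B , [ ⊥-elim ∘ x≢w , id ] ] (all x)
    ... | x , ¬excused = x , ¬excused ∘ inj₁ , ¬excused ∘ inj₂ ∘ inj₁ , ¬excused ∘ inj₂ ∘ inj₂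

    coEdge-sym : ∀ {u v} → CoEdge Φ B u v → CoEdge Φ B v u
    coEdge-sym (u≢B , v≢B , u≢v , ¬u~v) = v≢B , u≢B , u≢v ∘ sym , ¬u~v ∘ adj-sym

    sameCoComp-sym : ∀ {u v} → SameCoComp Φ B u v → SameCoComp Φ B v u
    sameCoComp-sym = reverse coEdge-sym

module Rotation (n : ℕ) where

  inc : ℕ → ℕ
  inc x with x <? n
  ... | yes _ = suc x
  ... | no _  = zero

  dec : ℕ → ℕ
  dec zero    = n
  dec (suc x) = x

  inc-< : ∀ {x} → x < n → inc x ≡ suc x
  inc-< {x} x<n with x <? n
  ... | yes _  = refl
  ... | no x≮n = contradiction x<n x≮n

  inc-n : inc n ≡ 0
  inc-n with n <? n
  ... | yes n<n = contradiction refl (<⇒≢ n<n)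
  ... | no _    = refl

  inc-dec : ∀ {x} → x ≤ n → inc (dec x) ≡ x
  inc-dec {zero}  _   = inc-n
  inc-dec {suc x} x<n = inc-< x<n

  dec-inc : ∀ {x} → x ≤ n → dec (inc x) ≡ x
  dec-inc {x} x≤n with x <? n
  ... | yes _  = refl
  ... | no x≮n = ≤-antisym (≮⇒≥ x≮n) x≤n

  dec≤n : ∀ {x} → x ≤ n → dec x ≤ n
  dec≤n {zero}  _   = ≤-refl
  dec≤n {suc x} x<n = <⇒≤ x<n

  dec-injective : ∀ {x y} → x ≤ n → y ≤ n → dec x ≡ dec y → x ≡ y
  dec-injective x≤n y≤n e = trans (sym (inc-dec x≤n)) (trans (cong inc e) (inc-dec y≤n))

  arc-dec : ∀ {x y z} → x ≤ n → y ≤ n → z ≤ n → Arc x y z → Arc (dec x) (dec y) (dec z)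
  arc-dec {zero}  {zero}  {zero}  _  _   _  _                            = linear ≤-refl ≤-refl
  arc-dec {zero}  {zero}  {suc z} _  _   _  (linear _ ())
  arc-dec {zero}  {zero}  {suc z} _  _   _  (wrap-above () _)
  arc-dec {zero}  {zero}  {suc z} _  _   _  (wrap-below () _)
  arc-dec {zero}  {suc y} {zero}  _  y<n _  _                            = wrap-above y<n ≤-refl
  arc-dec {zero}  {suc y} {suc z} _  y<n _  (linear _ (s≤s z≤y))         = wrap-below y<n z≤y
  arc-dec {zero}  {suc y} {suc z} _  _   _  (wrap-above () _)
  arc-dec {zero}  {suc y} {suc z} _  _   _  (wrap-below () _)
  arc-dec {suc x} {zero}  {zero}  x<n _  _  _                            = linear (<⇒≤ x<n) ≤-refl
  arc-dec {suc x} {zero}  {suc z} _  _   _  (linear _ ())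
  arc-dec {suc x} {zero}  {suc z} _  _   z<n (wrap-above _ (s≤s x≤z))    = linear x≤z (<⇒≤ z<n)
  arc-dec {suc x} {zero}  {suc z} _  _   _  (wrap-below _ ())
  arc-dec {suc x} {suc y} {zero}  _  _   _  (linear () _)
  arc-dec {suc x} {suc y} {zero}  _  _   _  (wrap-above _ ())
  arc-dec {suc x} {suc y} {zero}  x<n _  _  (wrap-below (s≤s y<x) _)     = wrap-above y<x (<⇒≤ x<n)
  arc-dec {suc x} {suc y} {suc z} _  _   _  (linear (s≤s x≤z) (s≤s z≤y)) = linear x≤z z≤y
  arc-dec {suc x} {suc y} {suc z} _  _   _  (wrap-above (s≤s y<x) (s≤s x≤z)) = wrap-above y<x x≤z
  arc-dec {suc x} {suc y} {suc z} _  _   _  (wrap-below (s≤s y<x) (s≤s z≤y)) = wrap-below y<x z≤y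

  arc-dec⁻¹ : ∀ {x y z} → x ≤ n → y ≤ n → z ≤ n → Arc (dec x) (dec y) (dec z) → Arc x y z
  arc-dec⁻¹ {zero}  {zero}  {zero}  _   _   _   _                  = linear ≤-refl ≤-refl
  arc-dec⁻¹ {zero}  {zero}  {suc z} _   _   z<n (linear n≤z _)     = contradiction n≤z (<⇒≱ z<n)
  arc-dec⁻¹ {zero}  {zero}  {suc z} _   _   _   (wrap-above n<n _) = contradiction refl (<⇒≢ n<n)
  arc-dec⁻¹ {zero}  {zero}  {suc z} _   _   _   (wrap-below n<n _) = contradiction refl (<⇒≢ n<n)
  arc-dec⁻¹ {zero}  {suc y} {zero}  _   _   _   _                  = linear z≤n z≤n
  arc-dec⁻¹ {zero}  {suc y} {suc z} _   _   z<n (linear n≤z _)     = contradiction n≤z (<⇒≱ z<n)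
  arc-dec⁻¹ {zero}  {suc y} {suc z} _   _   z<n (wrap-above _ n≤z) = contradiction n≤z (<⇒≱ z<n)
  arc-dec⁻¹ {zero}  {suc y} {suc z} _   _   _   (wrap-below _ z≤y) = linear z≤n (s≤s z≤y)
  arc-dec⁻¹ {suc x} {zero}  {zero}  _   _   _   _                  = wrap-below z<s z≤n
  arc-dec⁻¹ {suc x} {zero}  {suc z} _   _   _   (linear x≤z _)     = wrap-above z<s (s≤s x≤z)
  arc-dec⁻¹ {suc x} {zero}  {suc z} x<n _   _   (wrap-above n<x _) = contradiction (<⇒≤ x<n) (<⇒≱ n<x)
  arc-dec⁻¹ {suc x} {zero}  {suc z} x<n _   _   (wrap-below n<x _) = contradiction (<⇒≤ x<n) (<⇒≱ n<x)
  arc-dec⁻¹ {suc x} {suc y} {zero}  _   y<n _   (linear _ n≤y)     = contradiction n≤y (<⇒≱ y<n)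
  arc-dec⁻¹ {suc x} {suc y} {zero}  _   _   _   (wrap-above y<x _) = wrap-below (s≤s y<x) z≤n
  arc-dec⁻¹ {suc x} {suc y} {zero}  _   y<n _   (wrap-below _ n≤y) = contradiction n≤y (<⇒≱ y<n)
  arc-dec⁻¹ {suc x} {suc y} {suc z} _   _   _   (linear x≤z z≤y)     = linear (s≤s x≤z) (s≤s z≤y)
  arc-dec⁻¹ {suc x} {suc y} {suc z} _   _   _   (wrap-above y<x x≤z) = wrap-above (s≤s y<x) (s≤s x≤z)
  arc-dec⁻¹ {suc x} {suc y} {suc z} _   _   _   (wrap-below y<x z≤y) = wrap-below (s≤s y<x) (s≤s z≤y)

  shift : ℕ → ℕ → ℕ
  shift zero    x = x
  shift (suc m) x = shift m (dec x)

  shift≤n : ∀ m {x} → x ≤ n → shift m x ≤ n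
  shift≤n zero    x≤n = x≤n
  shift≤n (suc m) x≤n = shift≤n m (dec≤n x≤n)

  shift-self : ∀ m → shift m m ≡ 0
  shift-self zero    = refl
  shift-self (suc m) = shift-self m

  shift-injective : ∀ m {x y} → x ≤ n → y ≤ n → shift m x ≡ shift m y → x ≡ y
  shift-injective zero    _   _   e = e
  shift-injective (suc m) x≤n y≤n e =
    dec-injective x≤n y≤n (shift-injective m (dec≤n x≤n) (dec≤n y≤n) e)

  shift-inc : ∀ m {x} → x ≤ n → shift m (inc x) ≡ inc (shift m x)
  shift-inc zero    _       = refl
  shift-inc (suc m) {x} x≤n = begin
    shift m (dec (inc x))   ≡⟨ cong (shift m) (dec-inc x≤n) ⟩
    shift m x               ≡⟨ cong (shift m) (inc-dec x≤n) ⟨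
    shift m (inc (dec x))   ≡⟨ shift-inc m (dec≤n x≤n) ⟩
    inc (shift m (dec x))   ∎
    where open ≡-Reasoning

  arc-shift : ∀ m {x y z} → x ≤ n → y ≤ n → z ≤ n → Arc x y z → Arc (shift m x) (shift m y) (shift m z)
  arc-shift zero    _   _   _   a = a
  arc-shift (suc m) hx hy hz a =
    arc-shift m (dec≤n hx) (dec≤n hy) (dec≤n hz) (arc-dec hx hy hz a)

  arc-shift⁻¹ : ∀ m {x y z} → x ≤ n → y ≤ n → z ≤ n → Arc (shift m x) (shift m y) (shift m z) → Arc x y z
  arc-shift⁻¹ zero    _   _   _   a = a
  arc-shift⁻¹ (suc m) hx hy hz a =
    arc-dec⁻¹ hx hy hz (arc-shift⁻¹ m (dec≤n hx) (dec≤n hy) (dec≤n hz) a)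

toℕ-next : ∀ {n} (i : Fin (suc n)) → toℕ (next i) ≡ Rotation.inc n (toℕ i)
toℕ-next {n} i with toℕ i <? n
... | yes i<n = toℕ-fromℕ< (s≤s i<n)
... | no _    = refl

-- pos w is the position of w in the cyclic order when B is put at position 0,
-- and right w the position of F_r(w).
module Positions {n : ℕ} (Φ : RoundRep (suc n)) (B : Fin (suc n)) where
  open Rotation n

  toℕ≤n : (w : Fin (suc n)) → toℕ w ≤ n
  toℕ≤n w = ≤-pred (toℕ<n w)

  pos : Fin (suc n) → ℕ
  pos w = shift (toℕ B) (toℕ w)

  right : Fin (suc n) → ℕ
  right w = pos (Fr Φ w)

  Same : Fin (suc n) → Fin (suc n) → Set
  Same = SameCoComp Φ B

  pos≤n : ∀ w → pos w ≤ n
  pos≤n w = shift≤n (toℕ B) (toℕ≤n w)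

  pos-B : pos B ≡ 0
  pos-B = shift-self (toℕ B)

  pos-injective : ∀ {u v} → pos u ≡ pos v → u ≡ v
  pos-injective {u} {v} e = toℕ-injective (shift-injective (toℕ B) (toℕ≤n u) (toℕ≤n v) e)

  pos-next : ∀ u → pos (next u) ≡ inc (pos u)
  pos-next u = trans (cong (shift (toℕ B)) (toℕ-next u)) (shift-inc (toℕ B) (toℕ≤n u))

  pos-next-< : ∀ {u} → pos u < n → pos (next u) ≡ suc (pos u)
  pos-next-< {u} u<n = trans (pos-next u) (inc-< u<n)

  pos-next-last : ∀ {u} → pos u ≡ n → next u ≡ B
  pos-next-last {u} u≡n = pos-injective (trans (pos-next u) (trans (cong inc u≡n) (trans inc-n (sym pos-B))))

  arc-pos : ∀ i j w → InInterval i j w → Arc (pos i) (pos j) (pos w)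
  arc-pos i j w h = arc-shift (toℕ B) (toℕ≤n i) (toℕ≤n j) (toℕ≤n w) (inInterval⇒arc i j w h)

  arc-pos⁻¹ : ∀ i j w → Arc (pos i) (pos j) (pos w) → InInterval i j w
  arc-pos⁻¹ i j w a = arc⇒inInterval i j w (arc-shift⁻¹ (toℕ B) (toℕ≤n i) (toℕ≤n j) (toℕ≤n w) a)

  arc-round : ∀ u → Arc (pos u) (right (next u)) (right u)
  arc-round u = arc-pos u (Fr Φ (next u)) (Fr Φ u) (round Φ u)

  same-pos : ∀ {u v} → pos u ≡ pos v → Same u v
  same-pos {u} e = subst (Same u) (pos-injective e) ε

  pos-<⇒≢ : ∀ {u v} → pos u < pos v → u ≢ v
  pos-<⇒≢ u<v = <⇒≢ u<v ∘ cong pos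

  coEdge : ∀ {u v} → u ≢ B → v ≢ B → pos u ≢ pos v → ¬ Adj Φ u v → CoEdge Φ B u v
  coEdge u≢B v≢B u≢v ¬u~v = u≢B , v≢B , u≢v ∘ cong pos , ¬u~v

  right-B<candidate : ∀ {w} → Candidate Φ B w → right B < pos w
  right-B<candidate {w} (w≢B , _ , ¬B~w) with right B <? pos w
  ... | yes rB<w = rB<w
  ... | no rB≮w  = contradiction (inj₁ (arc-pos⁻¹ B (Fr Φ B) w B-arc , w≢B)) ¬B~w
    where
    B-arc : Arc (pos B) (right B) (pos w)
    B-arc = subst (λ p → Arc p (right B) (pos w)) (sym pos-B) (linear z≤n (≮⇒≥ rB≮w))

  candidate-unwrapped : ∀ {w} → Candidate Φ B w → pos w ≤ right w
  candidate-unwrapped {w} (w≢B , _ , ¬B~w) with right w <? pos w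
  ... | no rw≮w  = ≮⇒≥ rw≮w
  ... | yes rw<w = contradiction (inj₂ (arc-pos⁻¹ w (Fr Φ w) B w-arc , w≢B ∘ sym)) ¬B~w
    where
    w-arc : Arc (pos w) (right w) (pos B)
    w-arc = subst (Arc (pos w) (right w)) (sym pos-B) (wrap-below rw<w z≤n)

  candidate-⇒ : ∀ {u v} → Candidate Φ B u → _⇒_ Φ u v → pos u ≤ pos v × pos v ≤ right u
  candidate-⇒ {u} {v} cu (u⇒v , _) = arc-linear (arc-pos u (Fr Φ u) v u⇒v) (candidate-unwrapped cu)

  -- Roundness puts F_r(u) on [u, F_r(next u)], so the arc of next u still covers t unless t = u.
  arc-step : ∀ u {t} → pos u < n → Arc (pos u) (right u) t → t ≢ pos u
           → Arc (pos (next u)) (right (next u)) t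
  arc-step u u<n a t≢u = subst (λ p → Arc p (right (next u)) _) (sym (pos-next-< u<n))
                               (arc-drop-start (arc-trans a (arc-round u)) t≢u)

  propagate : ∀ m u {t} → pos u + m ≤ n → t < pos u ⊎ pos u + m ≤ t → Arc (pos u) (right u) t
            → ∃ λ w → pos w ≡ pos u + m × Arc (pos w) (right w) t
  propagate zero    u _     _       a = u , sym (+-identityʳ (pos u)) , a
  propagate (suc m) u {t} bound outside a =
    let w , w≡ , aw = propagate m (next u) bound′ outside′ (arc-step u u<n a t≢u)
    in  w , trans w≡ moved , aw
    where
    u<n : pos u < n
    u<n = <-≤-trans (m<m+n (pos u) z<s) bound
    moved : pos (next u) + m ≡ pos u + suc m
    moved = trans (cong (_+ m) (pos-next-< u<n)) (sym (+-suc (pos u) m))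
    bound′ : pos (next u) + m ≤ n
    bound′ = subst (_≤ n) (sym moved) bound
    t≢u : t ≢ pos u
    t≢u = [ <⇒≢ , (λ le → >⇒≢ (<-≤-trans (m<m+n (pos u) z<s) le)) ] outside
    outside′ : t < pos (next u) ⊎ pos (next u) + m ≤ t
    outside′ = [ (λ t<u → inj₁ (subst (t <_) (sym (pos-next-< u<n)) (m<n⇒m<1+n t<u)))
               , (λ le → inj₂ (subst (_≤ t) (sym moved) le)) ] outside

  right-monotone : ∀ {a b} → pos a < pos b → pos b ≤ right a → Arc (pos b) (right b) (right a)
  right-monotone {a} {b} a<b b≤ra =
    let w , w≡ , aw = propagate (pos b ∸ pos a) a (≤-trans (≤-reflexive gap) (pos≤n b))
                                (inj₂ (≤-trans (≤-reflexive gap) b≤ra)) (arc-end _ _)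
    in  subst (λ v → Arc (pos v) (right v) (right a)) (pos-injective (trans w≡ gap)) aw
    where
    gap : pos a + (pos b ∸ pos a) ≡ pos b
    gap = m+[n∸m]≡n (<⇒≤ a<b)

  -- Carry F_r(x) along to the last position, whose successor is B.
  wrapped⇒right≤right-B : ∀ x → right x < pos x → right x ≤ right B
  wrapped⇒right≤right-B x rx<x =
    let w , w≡ , aw = propagate (n ∸ pos x) x (≤-reflexive to-end) (inj₁ rx<x) (arc-end _ _)
        w≡n = trans w≡ to-end
        last-arc = subst₂ (λ p v → Arc p (right v) (right x)) w≡n (pos-next-last w≡n)
                          (arc-trans aw (arc-round w))
    in  proj₂ (arc-below-start last-arc (<-≤-trans rx<x (pos≤n x)))
    where
    to-end : pos x + (n ∸ pos x) ≡ n
    to-end = m+[n∸m]≡n (pos≤n x)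

  ¬wrapped-onto-candidate : ∀ {a x} → Candidate Φ B a → pos a < pos x → ¬ Arc (pos x) (right x) (pos a)
  ¬wrapped-onto-candidate {a} {x} ca a<x xa =
    let rx<x , a≤rx = arc-below-start xa a<x
    in  <⇒≱ (right-B<candidate ca) (≤-trans a≤rx (wrapped⇒right≤right-B x rx<x))

  ¬adj-transferˡ : ∀ {x b c} → Candidate Φ B c → pos x < pos b → pos b < pos c
                 → ¬ Adj Φ b x → ¬ Adj Φ x c
  ¬adj-transferˡ {x} {b} {c} _ x<b b<c ¬b~x (inj₁ (x⇒c , _)) =
    ¬b~x (inj₂ (arc-pos⁻¹ x (Fr Φ x) b x⇒b , pos-<⇒≢ x<b ∘ sym))
    where
    x⇒b = arc-prefix (arc-pos x (Fr Φ x) c x⇒c) (<⇒≤ x<b) (<⇒≤ b<c)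
  ¬adj-transferˡ cc x<b b<c _ (inj₂ c⇒x) =
    <⇒≱ (<-trans x<b b<c) (proj₁ (candidate-⇒ cc c⇒x))

  ¬adj-transferʳ : ∀ {a b x} → Candidate Φ B a → Candidate Φ B b → pos a < pos b → pos b < pos x
                 → _⇒_ Φ a b → ¬ Adj Φ b x → ¬ Adj Φ a x
  ¬adj-transferʳ {a} {b} {x} ca cb a<b b<x a⇒b ¬b~x (inj₁ a⇒x) =
    ¬b~x (inj₁ (arc-pos⁻¹ b (Fr Φ b) x (linear (<⇒≤ b<x) x≤rb) , pos-<⇒≢ b<x ∘ sym))
    where
    b≤ra = proj₂ (candidate-⇒ ca a⇒b)
    ra≤rb = proj₂ (arc-linear (right-monotone a<b b≤ra) (candidate-unwrapped cb))
    x≤rb = ≤-trans (proj₂ (candidate-⇒ ca a⇒x)) ra≤rb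
  ¬adj-transferʳ {a} {_} {x} ca _ a<b b<x _ _ (inj₂ (x⇒a , _)) =
    ¬wrapped-onto-candidate ca (<-trans a<b b<x) (arc-pos x (Fr Φ x) a x⇒a)

  middle-shares-< : ∀ {a b c} → Candidate Φ B a → Candidate Φ B b → Candidate Φ B c
                  → pos a < pos b → pos b < pos c → Same b a ⊎ Same b c
  middle-shares-< {a} {b} ca@(a≢B , _) cb@(b≢B , b-nonuniversal , _) cc@(c≢B , _) a<b b<c
    with adj? Φ a b
  ... | no ¬a~b = inj₁ (coEdge b≢B a≢B (>⇒≢ a<b) (¬a~b ∘ adj-sym Φ) ◅ ε)
  ... | yes (inj₂ b⇒a) = contradiction (proj₁ (candidate-⇒ cb b⇒a)) (<⇒≱ a<b)
  ... | yes (inj₁ a⇒b) with ¬universal⇒non-neighbour Φ B b b-nonuniversal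
  ... | x , x≢B , x≢b , ¬b~x with <-cmp (pos x) (pos b)
  ... | tri≈ _ x≡b _ = contradiction (pos-injective x≡b) x≢b
  ... | tri< x<b _ _ = inj₂ (coEdge b≢B x≢B (>⇒≢ x<b) ¬b~x
                           ◅ coEdge x≢B c≢B (<⇒≢ (<-trans x<b b<c)) (¬adj-transferˡ cc x<b b<c ¬b~x) ◅ ε)
  ... | tri> _ _ b<x = inj₁ (coEdge b≢B x≢B (<⇒≢ b<x) ¬b~x
                           ◅ coEdge x≢B a≢B (>⇒≢ (<-trans a<b b<x))
                                    (¬adj-transferʳ ca cb a<b b<x a⇒b ¬b~x ∘ adj-sym Φ) ◅ ε)

  middle-shares : ∀ {a b c} → Candidate Φ B a → Candidate Φ B b → Candidate Φ B c
                → pos a ≤ pos b → pos b ≤ pos c → Same b a ⊎ Same b c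
  middle-shares ca cb cc a≤b b≤c with m≤n⇒m<n∨m≡n a≤b | m≤n⇒m<n∨m≡n b≤c
  ... | inj₂ a≡b | _         = inj₁ (same-pos (sym a≡b))
  ... | inj₁ _   | inj₂ b≡c  = inj₂ (same-pos b≡c)
  ... | inj₁ a<b | inj₁ b<c  = middle-shares-< ca cb cc a<b b<c

  module _ {W₁ W₂ W₃ : Fin (suc n)} where

    SomePair : Set
    SomePair = Same W₁ W₂ ⊎ Same W₁ W₃ ⊎ Same W₂ W₃

    middle₁ : Same W₁ W₂ ⊎ Same W₁ W₃ → SomePair
    middle₁ = [ inj₁ , inj₂ ∘ inj₁ ]

    middle₂ : Same W₂ W₁ ⊎ Same W₂ W₃ → SomePair
    middle₂ = [ inj₁ ∘ sameCoComp-sym Φ B , inj₂ ∘ inj₂ ]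

    middle₃ : Same W₃ W₁ ⊎ Same W₃ W₂ → SomePair
    middle₃ = [ inj₂ ∘ inj₁ ∘ sameCoComp-sym Φ B , inj₂ ∘ inj₂ ∘ sameCoComp-sym Φ B ]

    candidates-share : Candidate Φ B W₁ → Candidate Φ B W₂ → Candidate Φ B W₃ → SomePair
    candidates-share c₁ c₂ c₃
      with ≤-total (pos W₁) (pos W₂) | ≤-total (pos W₂) (pos W₃) | ≤-total (pos W₁) (pos W₃)
    ... | inj₁ 1≤2 | inj₁ 2≤3 | _        = middle₂ (middle-shares c₁ c₂ c₃ 1≤2 2≤3)
    ... | inj₁ 1≤2 | inj₂ 3≤2 | inj₁ 1≤3 = middle₃ (middle-shares c₁ c₃ c₂ 1≤3 3≤2)
    ... | inj₁ 1≤2 | inj₂ 3≤2 | inj₂ 3≤1 = middle₁ (swap (middle-shares c₃ c₁ c₂ 3≤1 1≤2))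
    ... | inj₂ 2≤1 | inj₁ 2≤3 | inj₁ 1≤3 = middle₁ (middle-shares c₂ c₁ c₃ 2≤1 1≤3)
    ... | inj₂ 2≤1 | inj₁ 2≤3 | inj₂ 3≤1 = middle₃ (swap (middle-shares c₂ c₃ c₁ 2≤3 3≤1))
    ... | inj₂ 2≤1 | inj₂ 3≤2 | _        = middle₂ (swap (middle-shares c₃ c₂ c₁ 3≤2 2≤1))

lemma24 : ∀ {k : ℕ} (Φ : RoundRep k) (B : Fin k) (W₁ W₂ W₃ : Fin k)
            → Candidate Φ B W₁ → Candidate Φ B W₂ → Candidate Φ B W₃
            → SameCoComp Φ B W₁ W₂ ⊎ SameCoComp Φ B W₁ W₃ ⊎ SameCoComp Φ B W₂ W₃
lemma24 {zero}  _ ()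
lemma24 {suc n} Φ B _ _ _ = Positions.candidates-share Φ B
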